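{- Let $\langle V,T,v_0,B\rangle$ be a tree with back-edges, with $V$ finite, and let $k\ge 1$ be an integer. Suppose that $0<\ell(d,a)\le k$ for every back edge $(d,a)\in B$. Then $|T\cup B|\le (k+1)|V|-1$.
   Context: A pointed digraph $\langle V,T,v_0\rangle$ (with $T\subseteq V\times V$) is a tree if for each $v\in V$ there is a unique directed path in $(V,T)$ from $v_0$ to $v$. A vertex $y$ is an ancestor of $x$ if $y$ lies on the unique path from $v_0$ to $x$. A tree with back-edges is a tuple $\langle V,T,v_0,B\rangle$ such that $\langle V,T,v_0\rangle$ is a tree and $B\subseteq V\times V$ satisfies: if $(x,y)\in B$ then $y$ is an ancestor of $x$ in the tree $\langle V,T,v_0\rangle$. Elements of $B$ are called back edges. For $v\in V$, $\delta(v)$ denotes the length of the unique path from $v_0$ to $v$ in the tree, and for a back edge $(d,a)\in B$ one sets $\ell(d,a)=\delta(d)-\delta(a)+1$. -}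

module Defs where

open import Data.Nat using (ℕ; zero; suc; _+_)
open import Data.Bool using (Bool; true; false; _∨_; if_then_else_)
open import Data.Fin using (Fin)
open import Data.List using (List; []; _∷_; map; allFin)
open import Data.Nat.ListAction using (sum)
open import Data.Product using (_×_)
open import Data.Integer as ℤ using (ℤ; +_)
open import Relation.Binary.PropositionalEquality using (_≡_)

EdgeSet : ℕ → Set
EdgeSet n = Fin n → Fin n → Bool

data Path {n : ℕ} (E : EdgeSet n) (x : Fin n) : Fin n → Set where
  here : Path E x x
  step : ∀ {y z} → Path E x y → E y z ≡ true → Path E x z

len : ∀ {n} {E : EdgeSet n} {x y} → Path E x y → ℕ
len here       = 0
len (step p _) = suc (len p)

data OnPath {n : ℕ} {E : EdgeSet n} {x : Fin n} (v : Fin n) :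
            {y : Fin n} → Path E x y → Set where
  atStart : v ≡ x → OnPath v here
  atEnd   : ∀ {y z} {p : Path E x y} {e : E y z ≡ true} → v ≡ z → OnPath v (step p e)
  before  : ∀ {y z} {p : Path E x y} {e : E y z ≡ true} → OnPath v p → OnPath v (step p e)

record IsTree {n : ℕ} (T : EdgeSet n) (v0 : Fin n) : Set where
  field
    path   : (v : Fin n) → Path T v0 v
    unique : (v : Fin n) (p q : Path T v0 v) → p ≡ q

module _ {n : ℕ} {T : EdgeSet n} {v0 : Fin n} (tr : IsTree T v0) where
  open IsTree tr

  depth : Fin n → ℕ
  depth v = len (path v)

  Ancestor : Fin n → Fin n → Set
  Ancestor y x = OnPath y (path x)

  ell : Fin n → Fin n → ℤ
  ell d a = (+ depth d) ℤ.- (+ depth a) ℤ.+ (+ 1)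

record IsTreeWithBackEdges {n : ℕ} (T : EdgeSet n) (v0 : Fin n) (B : EdgeSet n) : Set where
  field
    tree : IsTree T v0
    back : ∀ x y → B x y ≡ true → Ancestor tree y x

card : ∀ {n} → EdgeSet n → ℕ
card {n} E = sum (map (λ x → sum (map (λ y → if E x y then 1 else 0) (allFin n))) (allFin n))

_∪E_ : ∀ {n} → EdgeSet n → EdgeSet n → EdgeSet n
(E ∪E F) x y = E x y ∨ F x y

-- Every vertex other than the root has exactly one tree parent, so |T| ≤ |V| − 1.
-- The heads of the back edges leaving d are ancestors of d, hence have pairwise
-- distinct depths, and ℓ(d,a) ≤ k confines those depths to the k values
-- δ(d) − k + 1, …, δ(d). So every vertex is the tail of at most k back edges,
-- and |T ∪ B| ≤ |T| + |B| ≤ (|V| − 1) + k|V|.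
module Submission where

open import Defs
open import Data.Nat using (ℕ; zero; suc; _≤_; _<_; _*_; _∸_; _+_; _≡ᵇ_; z≤n; s≤s)
open import Data.Nat.Properties
open import Data.Nat.ListAction using (sum)
open import Data.Bool using (Bool; true; false; T; _∧_; _∨_; not; if_then_else_)
open import Data.Bool.Properties using (∧-conicalˡ; ∧-conicalʳ)
open import Data.Fin using (Fin)
open import Data.List using (List; []; _∷_; map; allFin; length)
open import Data.List.Properties using (length-tabulate)
open import Data.List.Relation.Unary.All as All using (All; []; _∷_)
open import Data.List.Relation.Unary.Any using (here; there)
open import Data.List.Relation.Unary.AllPairs using ([]; _∷_)
open import Data.List.Relation.Unary.Unique.Propositional using (Unique)
open import Data.List.Relation.Unary.Unique.Propositional.Properties using (allFin⁺)
open import Data.List.Membership.Propositional using (_∈_)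
open import Data.List.Membership.Propositional.Properties using (∈-allFin)
open import Data.Product using (_×_; _,_; proj₂)
open import Data.Empty using (⊥-elim)
open import Data.Integer as ℤ using (+_)
import Data.Integer.Properties as ℤ
open import Data.Integer.Tactic.RingSolver using (solve-∀)
open import Algebra.Properties.CommutativeSemigroup +-commutativeSemigroup using (interchange)
open import Function using (id)
open import Relation.Binary.PropositionalEquality
  using (_≡_; _≢_; refl; sym; trans; cong; subst; module ≡-Reasoning)

indicator : Bool → ℕ
indicator b = if b then 1 else 0

count : {A : Set} → (A → Bool) → List A → ℕ
count p xs = sum (map (λ x → indicator (p x)) xs)

indicator-∨-≤ : ∀ a b → indicator (a ∨ b) ≤ indicator a + indicator b
indicator-∨-≤ false b = ≤-refl
indicator-∨-≤ true  b = m≤m+n 1 (indicator b)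

module _ {A : Set} where

  sum-map-mono : {f g : A → ℕ} (xs : List A) → (∀ x → f x ≤ g x) →
                 sum (map f xs) ≤ sum (map g xs)
  sum-map-mono []       _   = z≤n
  sum-map-mono (x ∷ xs) f≤g = +-mono-≤ (f≤g x) (sum-map-mono xs f≤g)

  sum-map-+ : (f g : A → ℕ) (xs : List A) →
              sum (map (λ x → f x + g x) xs) ≡ sum (map f xs) + sum (map g xs)
  sum-map-+ f g []       = refl
  sum-map-+ f g (x ∷ xs) = begin
    f x + g x + sum (map (λ x → f x + g x) xs)    ≡⟨ cong (λ s → f x + g x + s) (sum-map-+ f g xs) ⟩
    f x + g x + (sum (map f xs) + sum (map g xs)) ≡⟨ interchange (f x) (g x) _ _ ⟩
    f x + sum (map f xs) + (g x + sum (map g xs)) ∎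
    where open ≡-Reasoning

  sum-map-const : (c : ℕ) (xs : List A) → sum (map (λ _ → c) xs) ≡ length xs * c
  sum-map-const c []       = refl
  sum-map-const c (x ∷ xs) = cong (λ s → c + s) (sum-map-const c xs)

  sum-map-≤-length∸1 : (f : A → ℕ) {x₀ : A} {xs : List A} → x₀ ∈ xs → f x₀ ≡ 0 →
                       (∀ x → f x ≤ 1) → sum (map f xs) ≤ length xs ∸ 1
  sum-map-≤-length∸1 f {xs = _ ∷ xs} (here refl) f₀≡0 f≤1 rewrite f₀≡0 =
    ≤-trans (sum-map-mono xs f≤1) (≤-reflexive (trans (sum-map-const 1 xs) (*-identityʳ _)))
  sum-map-≤-length∸1 f {xs = x ∷ _ ∷ _} (there x₀∈) f₀≡0 f≤1 =
    +-mono-≤ (f≤1 x) (sum-map-≤-length∸1 f x₀∈ f₀≡0 f≤1)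

  count-none : (p : A → Bool) {xs : List A} → All (λ x → p x ≢ true) xs → count p xs ≡ 0
  count-none p []                 = refl
  count-none p (_∷_ {x} ¬px none) with p x
  ... | true  = ⊥-elim (¬px refl)
  ... | false = count-none p none

  count-≤1 : (p : A → Bool) {xs : List A} → Unique xs →
             (∀ x y → p x ≡ true → p y ≡ true → x ≡ y) → count p xs ≤ 1
  count-≤1 p []                      _         = z≤n
  count-≤1 p (_∷_ {x} x∉xs unique) p-unique with p x in px
  ... | true  = ≤-reflexive (cong suc (count-none p (All.map (λ x≢y py → x≢y (p-unique _ _ px py)) x∉xs)))
  ... | false = count-≤1 p unique p-unique

  count-∧-split : (p q : A → Bool) (xs : List A) →
                  count p xs ≡ count (λ x → p x ∧ q x) xs + count (λ x → p x ∧ not (q x)) xs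
  count-∧-split p q []       = refl
  count-∧-split p q (x ∷ xs) with p x | q x
  ... | false | _     = count-∧-split p q xs
  ... | true  | true  = cong suc (count-∧-split p q xs)
  ... | true  | false = trans (cong suc (count-∧-split p q xs)) (sym (+-suc _ _))

  count-≤-injective-interval : (p : A → Bool) (φ : A → ℕ) {xs : List A} → Unique xs →
    (∀ x y → p x ≡ true → p y ≡ true → φ x ≡ φ y → x ≡ y) →
    ∀ k L → (∀ x → p x ≡ true → L ≤ φ x × φ x < L + k) → count p xs ≤ k
  count-≤-injective-interval p φ {xs} unique φ-inj zero L in-interval =
    ≤-reflexive (count-none p (All.universal empty xs))
    where
    empty : ∀ x → p x ≢ true
    empty x px with in-interval x px
    ... | L≤φx , φx<L+0 = <⇒≱ (subst (φ _ <_) (+-identityʳ L) φx<L+0) L≤φx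
  count-≤-injective-interval p φ {xs} unique φ-inj (suc k) L in-interval = begin
    count p xs                   ≡⟨ count-∧-split p atL xs ⟩
    count onL xs + count offL xs ≤⟨ +-mono-≤ onL-≤1 offL-≤k ⟩
    1 + k                        ∎
    where
    open ≤-Reasoning
    atL onL offL : A → Bool
    atL x  = φ x ≡ᵇ L
    onL x  = p x ∧ atL x
    offL x = p x ∧ not (atL x)

    onL-≤1 : count onL xs ≤ 1
    onL-≤1 = count-≤1 onL unique λ x y ox oy →
      φ-inj x y (∧-conicalˡ _ _ ox) (∧-conicalˡ _ _ oy)
        (trans (≡ᵇ-true (∧-conicalʳ _ _ ox)) (sym (≡ᵇ-true (∧-conicalʳ _ _ oy))))
      where
      ≡ᵇ-true : ∀ {m n} → (m ≡ᵇ n) ≡ true → m ≡ n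
      ≡ᵇ-true {m} {n} e = ≡ᵇ⇒≡ m n (subst T (sym e) _)

    offL-≤k : count offL xs ≤ k
    offL-≤k = count-≤-injective-interval offL φ unique
      (λ x y ox oy → φ-inj x y (∧-conicalˡ _ _ ox) (∧-conicalˡ _ _ oy)) k (suc L) above-L
      where
      ≢-from-≡ᵇ : ∀ m n → not (m ≡ᵇ n) ≡ true → m ≢ n
      ≢-from-≡ᵇ m n e m≡n with m ≡ᵇ n | ≡⇒≡ᵇ m n m≡n
      ... | false | ()
      above-L : ∀ x → offL x ≡ true → suc L ≤ φ x × φ x < suc L + k
      above-L x ox with in-interval x (∧-conicalˡ _ _ ox)
      ... | L≤φx , φx<L+1+k =
        ≤∧≢⇒< L≤φx (λ L≡φx → ≢-from-≡ᵇ (φ x) L (∧-conicalʳ _ _ ox) (sym L≡φx)) ,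
        subst (φ x <_) (+-suc L k) φx<L+1+k

sum-map-comm : {A B : Set} (f : A → B → ℕ) (xs : List A) (ys : List B) →
  sum (map (λ x → sum (map (f x) ys)) xs) ≡ sum (map (λ y → sum (map (λ x → f x y) xs)) ys)
sum-map-comm f []       ys = sym (trans (sum-map-const 0 ys) (*-zeroʳ (length ys)))
sum-map-comm f (x ∷ xs) ys =
  trans (cong (λ s → sum (map (f x) ys) + s) (sum-map-comm f xs ys))
        (sym (sum-map-+ (f x) (λ y → sum (map (λ x → f x y) xs)) ys))

module _ {n : ℕ} where

  outDegree : EdgeSet n → Fin n → ℕ
  outDegree E x = count (E x) (allFin n)

  inDegree : EdgeSet n → Fin n → ℕ
  inDegree E y = count (λ x → E x y) (allFin n)

  length-allFin : length (allFin n) ≡ n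
  length-allFin = length-tabulate id

  card-∪E-≤ : (E F : EdgeSet n) → card (E ∪E F) ≤ card E + card F
  card-∪E-≤ E F = begin
    card (E ∪E F)                                                ≤⟨ sum-map-mono (allFin n) outDegree-∪E-≤ ⟩
    sum (map (λ x → outDegree E x + outDegree F x) (allFin n))  ≡⟨ sum-map-+ (outDegree E) (outDegree F) (allFin n) ⟩
    card E + card F                                              ∎
    where
    open ≤-Reasoning
    outDegree-∪E-≤ : ∀ x → outDegree (E ∪E F) x ≤ outDegree E x + outDegree F x
    outDegree-∪E-≤ x =
      ≤-trans (sum-map-mono (allFin n) (λ y → indicator-∨-≤ (E x y) (F x y)))
              (≤-reflexive (sum-map-+ (λ y → indicator (E x y)) (λ y → indicator (F x y)) (allFin n)))

  card-≤-outDegree : (E : EdgeSet n) (k : ℕ) → (∀ x → outDegree E x ≤ k) → card E ≤ n * k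
  card-≤-outDegree E k outDegree≤k = begin
    card E                               ≤⟨ sum-map-mono (allFin n) outDegree≤k ⟩
    sum (map (λ _ → k) (allFin n))       ≡⟨ sum-map-const k (allFin n) ⟩
    length (allFin n) * k                ≡⟨ cong (_* k) length-allFin ⟩
    n * k                                ∎
    where open ≤-Reasoning

  card-≤-inDegree : (E : EdgeSet n) (v₀ : Fin n) → inDegree E v₀ ≡ 0 →
                    (∀ y → inDegree E y ≤ 1) → card E ≤ n ∸ 1
  card-≤-inDegree E v₀ inDegree₀≡0 inDegree≤1 = begin
    card E                               ≡⟨ sum-map-comm (λ x y → indicator (E x y)) (allFin n) (allFin n) ⟩
    sum (map (inDegree E) (allFin n))    ≤⟨ sum-map-≤-length∸1 (inDegree E) (∈-allFin v₀) inDegree₀≡0 inDegree≤1 ⟩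
    length (allFin n) ∸ 1                ≡⟨ cong (_∸ 1) length-allFin ⟩
    n ∸ 1                                ∎
    where open ≤-Reasoning

module _ {n : ℕ} {E : EdgeSet n} {x : Fin n} where

  prefix : ∀ {v y} {p : Path E x y} → OnPath v p → Path E x v
  prefix (atStart refl)             = here
  prefix (atEnd {p = p} {e} refl)   = step p e
  prefix (before v∈p)               = prefix v∈p

  len-prefix-≤ : ∀ {v y} {p : Path E x y} (v∈p : OnPath v p) → len (prefix v∈p) ≤ len p
  len-prefix-≤ (atStart refl) = ≤-refl
  len-prefix-≤ (atEnd refl)   = ≤-refl
  len-prefix-≤ (before v∈p)   = m≤n⇒m≤1+n (len-prefix-≤ v∈p)

  prefix-len-injective : ∀ {v w y} {p : Path E x y} (v∈p : OnPath v p) (w∈p : OnPath w p) →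
                         len (prefix v∈p) ≡ len (prefix w∈p) → v ≡ w
  prefix-len-injective (atStart refl) (atStart refl) _  = refl
  prefix-len-injective (atEnd refl)   (atEnd refl)   _  = refl
  prefix-len-injective (atEnd refl)   (before w∈p)   eq = ⊥-elim (1+n≰n (≤-trans (≤-reflexive eq) (len-prefix-≤ w∈p)))
  prefix-len-injective (before v∈p)   (atEnd refl)   eq = ⊥-elim (1+n≰n (≤-trans (≤-reflexive (sym eq)) (len-prefix-≤ v∈p)))
  prefix-len-injective (before v∈p)   (before w∈p)   eq = prefix-len-injective v∈p w∈p eq

  penultimate : ∀ {z} → Path E x z → Fin n
  penultimate here              = x
  penultimate (step {y} _ _)    = y

module _ {n : ℕ} {T : EdgeSet n} {v₀ : Fin n} (tree : IsTree T v₀) where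
  open IsTree tree

  depth-ancestor : ∀ {a d} (a∈d : Ancestor tree a d) → depth tree a ≡ len (prefix a∈d)
  depth-ancestor {a} a∈d = cong len (unique a (path a) (prefix a∈d))

  ancestor⇒depth-≤ : ∀ {a d} → Ancestor tree a d → depth tree a ≤ depth tree d
  ancestor⇒depth-≤ a∈d = ≤-trans (≤-reflexive (depth-ancestor a∈d)) (len-prefix-≤ a∈d)

  ancestor-depth-injective : ∀ {a a′ d} (a∈d : Ancestor tree a d) (a′∈d : Ancestor tree a′ d) →
                             depth tree a ≡ depth tree a′ → a ≡ a′
  ancestor-depth-injective a∈d a′∈d eq =
    prefix-len-injective a∈d a′∈d (trans (sym (depth-ancestor a∈d)) (trans eq (depth-ancestor a′∈d)))

  ell≤⇒depth<depth+ : ∀ {d a} k → ell tree d a ℤ.≤ + k → depth tree d < depth tree a + k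
  ell≤⇒depth<depth+ {d} {a} k ell≤k = ℤ.drop‿+≤+ (begin
    + suc (depth tree d)               ≡⟨ ell+depth (+ depth tree d) (+ depth tree a) ⟩
    ell tree d a ℤ.+ + depth tree a   ≤⟨ ℤ.+-monoˡ-≤ (+ depth tree a) ell≤k ⟩
    + k ℤ.+ + depth tree a            ≡⟨ ℤ.+-comm (+ k) (+ depth tree a) ⟩
    + (depth tree a + k)               ∎)
    where
    open ℤ.≤-Reasoning
    ell+depth : ∀ δd δa → + 1 ℤ.+ δd ≡ ((δd ℤ.- δa) ℤ.+ + 1) ℤ.+ δa
    ell+depth = solve-∀

  parent-unique : ∀ {x x′ y} → T x y ≡ true → T x′ y ≡ true → x ≡ x′
  parent-unique {x} {x′} {y} e e′ = cong penultimate (unique y (step (path x) e) (step (path x′) e′))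

  root-has-no-parent : ∀ {x} → T x v₀ ≢ true
  root-has-no-parent {x} e with unique v₀ (step (path x) e) here
  ... | ()

  card-tree : card T ≤ n ∸ 1
  card-tree = card-≤-inDegree T v₀
    (count-none (λ x → T x v₀) (All.universal (λ _ → root-has-no-parent) (allFin n)))
    (λ y → count-≤1 (λ x → T x y) (allFin⁺ n) (λ _ _ → parent-unique))

module _ {n : ℕ} {T : EdgeSet n} {v₀ : Fin n} {B : EdgeSet n} (tb : IsTreeWithBackEdges T v₀ B) where
  open IsTreeWithBackEdges tb

  -- Depths are shifted by k so that the interval δ(d) + 1, …, δ(d) + k needs no truncated subtraction.
  outDegree-back-≤ : (k : ℕ) → (∀ d a → B d a ≡ true → ell tree d a ℤ.≤ + k) →
                     ∀ d → outDegree B d ≤ k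
  outDegree-back-≤ k ell≤k d =
    count-≤-injective-interval (B d) (λ a → depth tree a + k) (allFin⁺ n)
      (λ a a′ e e′ eq → ancestor-depth-injective tree (back d a e) (back d a′ e′) (+-cancelʳ-≡ k _ _ eq))
      k (suc (depth tree d))
      (λ a e → ell≤⇒depth<depth+ tree k (ell≤k d a e) ,
               +-monoˡ-< k (s≤s (ancestor⇒depth-≤ tree (back d a e))))

n∸1+n*k≡[k+1]*n∸1 : ∀ n k → n ∸ 1 + n * k ≡ (k + 1) * n ∸ 1
n∸1+n*k≡[k+1]*n∸1 zero    k = cong (_∸ 1) (sym (*-zeroʳ (k + 1)))
n∸1+n*k≡[k+1]*n∸1 (suc m) k = begin
  m + suc m * k         ≡⟨ cong (_+_ m) (*-comm (suc m) k) ⟩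
  suc m + k * suc m ∸ 1 ≡⟨ cong (λ c → c * suc m ∸ 1) (+-comm 1 k) ⟩
  (k + 1) * suc m ∸ 1   ∎
  where open ≡-Reasoning

mainTheorem1 : (n : ℕ) (T : EdgeSet n) (v0 : Fin n) (B : EdgeSet n)
    (tb : IsTreeWithBackEdges T v0 B) (k : ℕ) → 1 ≤ k →
    (∀ d a → B d a ≡ true →
      (+ 0 ℤ.< ell (IsTreeWithBackEdges.tree tb) d a)
        × (ell (IsTreeWithBackEdges.tree tb) d a ℤ.≤ + k)) →
    card (T ∪E B) ≤ (k + 1) * n ∸ 1
mainTheorem1 n T v0 B tb k _ ℓ-bounds = begin
  card (T ∪E B)     ≤⟨ card-∪E-≤ T B ⟩
  card T + card B   ≤⟨ +-mono-≤ (card-tree tree) (card-≤-outDegree B k (outDegree-back-≤ tb k ell≤k)) ⟩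
  n ∸ 1 + n * k     ≡⟨ n∸1+n*k≡[k+1]*n∸1 n k ⟩
  (k + 1) * n ∸ 1   ∎
  where
  open IsTreeWithBackEdges tb using (tree)
  open ≤-Reasoning
  ell≤k : ∀ d a → B d a ≡ true → ell tree d a ℤ.≤ + k
  ell≤k d a e = proj₂ (ℓ-bounds d a e)
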